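{- Let $p$ be an odd prime, $d$ a positive integer not divisible by $p$, and $1<J<p$. Let \[C_J=\left\{i'\in\mathbb{Z}\ \middle|\ 0<i'<\tfrac{(p-J)d}{p},\ p\nmid i'\right\},\quad R_J=\left\{(i,\lambda)\in\mathbb{Z}^2\ \middle|\ 0<\lambda<J,\ \tfrac{(p\lambda-J+1)d}{p^2}<i<\tfrac{(p(\lambda+1)-J)d}{p^2}\right\}.\] Let $T\subseteq R_J\times C_J$ be the set of $((i,\lambda),i')$ with $pi-i'\le\lambda d$, and define $\phi:T\to\mathbb{Z}$ by $\phi((i,\lambda),i')=pi-i'-(\lambda-1)d$ (whose values lie in $\{1,\dots,d\}$). Then: (1) $\phi((i,\lambda),i')\equiv pi-i'\pmod d$; (2) for fixed $(i,\lambda)$, the values $\phi((i,\lambda),i')$ for varying $i'$ are distinct; (3) for fixed $i'$, the values $\phi((i,\lambda),i')$ for varying $(i,\lambda)$ are distinct. -}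

module Defs where

open import Data.Nat using (ℕ)
open import Data.Integer using (ℤ; +_; _+_; _-_; _*_; _<_; _≤_; 0ℤ; 1ℤ)
open import Data.Integer.Divisibility using (_∣_)
open import Data.Product using (_×_)
open import Relation.Nullary using (¬_)

-- C_J membership: 0 < i' < (p-J)d/p and p ∤ i'.
-- The rational bound is written with the (positive) denominator p cleared:
--   i' < (p-J)d/p   ⇔   p·i' < (p-J)·d.
InC : (p d J : ℕ) → ℤ → Set
InC p d J i' = (0ℤ < i') × ((+ p) * i' < ((+ p) - (+ J)) * (+ d)) × ¬ ((+ p) ∣ i')

-- R_J membership of (i, l) (l plays the role of λ):
--   0 < l < J  and  (p l - J + 1) d / p² < i < (p (l+1) - J) d / p²,
-- with the positive denominator p² cleared.
InR : (p d J : ℕ) → ℤ → ℤ → Set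
InR p d J i l =
  (0ℤ < l) × (l < + J) ×
  ((((+ p) * l - (+ J)) + 1ℤ) * (+ d) < ((+ p) * (+ p)) * i) ×
  (((+ p) * (+ p)) * i < ((+ p) * (l + 1ℤ) - (+ J)) * (+ d))

InT : (p d J : ℕ) → ℤ → ℤ → ℤ → Set
InT p d J i l i' = InR p d J i l × InC p d J i' × ((+ p) * i - i' ≤ l * (+ d))

φ : (p d : ℕ) → ℤ → ℤ → ℤ → ℤ
φ p d i l i' = ((+ p) * i - i') - (l - 1ℤ) * (+ d)

{-# OPTIONS --safe #-}
-- If φ((i₁,λ₁),i') = φ((i₂,λ₂),i') then p (i₁ - i₂) = (λ₁ - λ₂) d; as p ∤ d and
-- |λ₁ - λ₂| < J < p, Euclid's lemma gives λ₁ = λ₂, and then i₁ = i₂.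
module Submission where

open import Defs
open import Data.Nat using (ℕ; _<_; zero; suc)
import Data.Nat as ℕ
import Data.Nat.Properties as ℕ
import Data.Nat.Divisibility as ℕD
open import Data.Nat.Primality using (Prime; euclidsLemma; prime⇒nonZero)
open import Data.Integer using (ℤ; +_; _-_; _*_; -_; ∣_∣; _⊖_; _≤_; 0ℤ; 1ℤ; +<+)
import Data.Integer as ℤ
import Data.Integer.Properties as ℤ
open import Data.Integer.Divisibility using (_∣_)
import Data.Integer.Divisibility.Signed as Signed
open import Algebra.Properties.AbelianGroup ℤ.+-0-abelianGroup
  using (∙-cancelˡ; ∙-cancelʳ; ⁻¹-injective; xyx⁻¹≈y)
open import Data.Integer.Tactic.RingSolver using (solve-∀)
open import Data.Product using (_×_; _,_)
open import Data.Sum using ([_,_]′)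
open import Data.Empty using (⊥-elim)
open import Relation.Nullary using (¬_)
open import Relation.Binary.PropositionalEquality
  using (_≡_; _≢_; refl; sym; trans; cong; cong₂; subst; module ≡-Reasoning)

n∣m∧m<n⇒m≡0 : ∀ {m n} → n ℕD.∣ m → m < n → m ≡ 0
n∣m∧m<n⇒m≡0 {zero}  _   _   = refl
n∣m∧m<n⇒m≡0 {suc m} n∣m m<n = ⊥-elim (ℕ.<⇒≱ m<n (ℕD.∣⇒≤ n∣m))

prime∣m*n∧∤n∧m<p⇒m≡0 : ∀ {p} m n → Prime p → ¬ p ℕD.∣ n → m < p → p ℕD.∣ m ℕ.* n → m ≡ 0
prime∣m*n∧∤n∧m<p⇒m≡0 m n p-prime p∤n m<p p∣mn =
  [ (λ p∣m → n∣m∧m<n⇒m≡0 p∣m m<p) , (λ p∣n → ⊥-elim (p∤n p∣n)) ]′ (euclidsLemma m n p-prime p∣mn)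

∣m⊖n∣<o : ∀ {m n o} → m < o → n < o → ∣ m ⊖ n ∣ < o
∣m⊖n∣<o {m} {n} m<o n<o = ℕ.≤-<-trans (ℤ.∣m⊝n∣≤m⊔n m n) (ℕ.⊔-pres-<m m<o n<o)

∣i-j∣<n : ∀ {i j n} → 0ℤ ≤ i → i ℤ.< + n → 0ℤ ≤ j → j ℤ.< + n → ∣ i - j ∣ < n
∣i-j∣<n {+ m} {+ k} _ (+<+ m<n) _ (+<+ k<n) =
  subst (_< _) (cong ∣_∣ (sym (ℤ.m-n≡m⊖n m k))) (∣m⊖n∣<o m<n k<n)

p*x≡k*d⇒x≡0×k≡0 : ∀ {p d} x k → Prime p → ¬ p ℕD.∣ d → ∣ k ∣ < p →
                  + p * x ≡ k * + d → x ≡ 0ℤ × k ≡ 0ℤ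
p*x≡k*d⇒x≡0×k≡0 {p} {d} x k p-prime p∤d ∣k∣<p px≡kd = x≡0 , k≡0
  where
  instance _ = prime⇒nonZero p-prime
  open ≡-Reasoning

  ∣k∣*d≡∣x∣*p : ∣ k ∣ ℕ.* d ≡ ∣ x ∣ ℕ.* p
  ∣k∣*d≡∣x∣*p = begin
    ∣ k ∣ ℕ.* d     ≡⟨ ℤ.abs-* k (+ d) ⟨
    ∣ k * + d ∣     ≡⟨ cong ∣_∣ px≡kd ⟨
    ∣ + p * x ∣     ≡⟨ ℤ.abs-* (+ p) x ⟩
    p ℕ.* ∣ x ∣     ≡⟨ ℕ.*-comm p ∣ x ∣ ⟩
    ∣ x ∣ ℕ.* p     ∎

  k≡0 : k ≡ 0ℤ
  k≡0 = ℤ.∣i∣≡0⇒i≡0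
    (prime∣m*n∧∤n∧m<p⇒m≡0 ∣ k ∣ d p-prime p∤d ∣k∣<p (ℕD.divides ∣ x ∣ ∣k∣*d≡∣x∣*p))

  x≡0 : x ≡ 0ℤ
  x≡0 = ℤ.*-cancelˡ-≡ (+ p) x 0ℤ (begin
    + p * x   ≡⟨ px≡kd ⟩
    k * + d   ≡⟨ cong (_* + d) k≡0 ⟩
    0ℤ        ≡⟨ ℤ.*-zeroʳ (+ p) ⟨
    + p * 0ℤ  ∎)

φ-≡-mod-d : ∀ p d i l i' → + d ∣ φ p d i l i' - (+ p * i - i')
φ-≡-mod-d p d i l i' = Signed.∣⇒∣ᵤ (subst (Signed._∣_ (+ d)) difference d∣-[l-1]*d)
  where
  difference : - ((l - 1ℤ) * + d) ≡ φ p d i l i' - (+ p * i - i')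
  difference = sym (xyx⁻¹≈y (+ p * i - i') (- ((l - 1ℤ) * + d)))

  d∣-[l-1]*d : + d Signed.∣ - ((l - 1ℤ) * + d)
  d∣-[l-1]*d = Signed.∣m⇒∣-m (Signed.∣n⇒∣m*n (l - 1ℤ) Signed.∣-refl)

φ-injectiveʳ : ∀ p d i l {i'₁ i'₂} → φ p d i l i'₁ ≡ φ p d i l i'₂ → i'₁ ≡ i'₂
φ-injectiveʳ p d i l eq =
  ⁻¹-injective (∙-cancelˡ (+ p * i) _ _ (∙-cancelʳ (- ((l - 1ℤ) * + d)) _ _ eq))

φ-≡⇒p*[i₁-i₂]≡[l₁-l₂]*d : ∀ p d i₁ l₁ i₂ l₂ i' →
  φ p d i₁ l₁ i' ≡ φ p d i₂ l₂ i' → + p * (i₁ - i₂) ≡ (l₁ - l₂) * + d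
φ-≡⇒p*[i₁-i₂]≡[l₁-l₂]*d p d i₁ l₁ i₂ l₂ i' eq =
  ℤ.i-j≡0⇒i≡j _ _ (trans (sym (difference (+ p) (+ d) i₁ l₁ i₂ l₂ i')) (ℤ.i≡j⇒i-j≡0 eq))
  where
  -- The ring solver abstracts only over variables, so + p and + d are generalised to P and D.
  difference : ∀ P D i₁ l₁ i₂ l₂ i' →
    ((P * i₁ - i') - (l₁ - 1ℤ) * D) - ((P * i₂ - i') - (l₂ - 1ℤ) * D) ≡ P * (i₁ - i₂) - (l₁ - l₂) * D
  difference = solve-∀

φ-injectiveˡ : ∀ {p d i₁ l₁ i₂ l₂} i' → Prime p → ¬ p ℕD.∣ d →
               0ℤ ≤ l₁ → l₁ ℤ.< + p → 0ℤ ≤ l₂ → l₂ ℤ.< + p →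
               φ p d i₁ l₁ i' ≡ φ p d i₂ l₂ i' → (i₁ , l₁) ≡ (i₂ , l₂)
φ-injectiveˡ {p} {d} {i₁} {l₁} {i₂} {l₂} i' p-prime p∤d 0≤l₁ l₁<p 0≤l₂ l₂<p eq
  with p*x≡k*d⇒x≡0×k≡0 (i₁ - i₂) (l₁ - l₂) p-prime p∤d
         (∣i-j∣<n 0≤l₁ l₁<p 0≤l₂ l₂<p) (φ-≡⇒p*[i₁-i₂]≡[l₁-l₂]*d p d i₁ l₁ i₂ l₂ i' eq)
... | i₁-i₂≡0 , l₁-l₂≡0 = cong₂ _,_ (ℤ.i-j≡0⇒i≡j i₁ i₂ i₁-i₂≡0) (ℤ.i-j≡0⇒i≡j l₁ l₂ l₁-l₂≡0)

proposition3p5 : (p d J : ℕ) → Prime p → p ≢ 2 → 0 < d → ¬ (p ℕD.∣ d) → 1 < J → J < p →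
    ((i l i' : ℤ) → InT p d J i l i' → (+ d) ∣ (φ p d i l i' - ((+ p) * i - i')))
    × ((i l i'₁ i'₂ : ℤ) → InT p d J i l i'₁ → InT p d J i l i'₂ → φ p d i l i'₁ ≡ φ p d i l i'₂ → i'₁ ≡ i'₂)
    × ((i₁ l₁ i₂ l₂ i' : ℤ) → InT p d J i₁ l₁ i' → InT p d J i₂ l₂ i' → φ p d i₁ l₁ i' ≡ φ p d i₂ l₂ i' → (i₁ , l₁) ≡ (i₂ , l₂))
proposition3p5 p d J p-prime _ _ p∤d _ J<p =
    (λ i l i' _ → φ-≡-mod-d p d i l i')
  , (λ i l _ _ _ _ → φ-injectiveʳ p d i l)
  , λ { _ _ _ _ i' ((0<l₁ , l₁<J , _) , _) ((0<l₂ , l₂<J , _) , _) →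
          φ-injectiveˡ i' p-prime p∤d (ℤ.<⇒≤ 0<l₁) (<J⇒<p l₁<J) (ℤ.<⇒≤ 0<l₂) (<J⇒<p l₂<J) }
  where
  <J⇒<p : ∀ {l} → l ℤ.< + J → l ℤ.< + p
  <J⇒<p l<J = ℤ.<-trans l<J (+<+ J<p)
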